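{- Let $T$ be a balanced tree of height $d>0$. Then $|V_{d-1}|>|V_d|$.
   Context: A leaf is a vertex of degree 1; the height of a vertex is its minimum distance to a leaf; $V_k$ is the set of vertices of height $k$; the height of $T$ is the largest $k$ with $V_k\neq\emptyset$. A tree is balanced if no two vertices of the same height are adjacent. -}

module Defs where

open import Data.Nat using (ℕ; zero; suc; _≤_)
open import Data.Bool using (Bool; true; false)
open import Data.Fin using (Fin)
open import Data.List using (List; []; _∷_; length; filterᵇ; allFin; last)
open import Data.List.Relation.Unary.Unique.Propositional using (Unique)
open import Data.List.Relation.Unary.Linked using (Linked)
open import Data.List.Membership.Propositional using (_∈_)
open import Data.Maybe using (just)
open import Data.Product using (Σ; _×_; ∃; ∃-syntax)
open import Relation.Binary.PropositionalEquality using (_≡_)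
open import Relation.Nullary using (¬_)
open import Function.Bundles using (_⇔_)

record Graph (n : ℕ) : Set where
  field
    adj   : Fin n → Fin n → Bool
    sym   : ∀ u v → adj u v ≡ adj v u
    irrefl : ∀ v → adj v v ≡ false

module _ {n : ℕ} (G : Graph n) where
  open Graph G

  Adj : Fin n → Fin n → Set
  Adj u v = adj u v ≡ true

  data Walk : Fin n → Fin n → ℕ → Set where
    here : ∀ {u} → Walk u u 0
    step : ∀ {u w v k} → Adj u w → Walk w v k → Walk u v (suc k)

  Connected : Set
  Connected = ∀ u v → ∃[ k ] Walk u v k

  IsCycle : List (Fin n) → Set
  IsCycle [] = Data.Empty.⊥ where import Data.Empty
  IsCycle (x ∷ xs) =
    (2 ≤ length xs) × Unique (x ∷ xs) × Linked Adj (x ∷ xs) ×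
    Σ (Fin n) (λ y → (last (x ∷ xs) ≡ just y) × Adj y x)

  Acyclic : Set
  Acyclic = ∀ xs → ¬ IsCycle xs

  IsTree : Set
  IsTree = Connected × Acyclic

  degree : Fin n → ℕ
  degree v = length (filterᵇ (adj v) (allFin n))

  Leaf : Fin n → Set
  Leaf v = degree v ≡ 1

  HasHeight : Fin n → ℕ → Set
  HasHeight v k =
    (∃[ ℓ ] Leaf ℓ × Walk v ℓ k) ×
    (∀ ℓ m → Leaf ℓ → Walk v ℓ m → k ≤ m)

  V : ℕ → Fin n → Set
  V k v = HasHeight v k

  TreeHeight : ℕ → Set
  TreeHeight d = (∃[ v ] V d v) × (∀ v k → V k v → k ≤ d)

  Balanced : Set
  Balanced = ∀ u v k → Adj u v → V k u → V k v → Data.Empty.⊥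
    where import Data.Empty

Card : {n : ℕ} → (Fin n → Set) → ℕ → Set
Card {n} P m = Σ (List (Fin n)) λ xs →
  Unique xs × (∀ v → (v ∈ xs) ⇔ P v) × (length xs ≡ m)

-- Root the tree at a neighbour r of some vertex of maximal height d + 1; r has
-- height d, and so has every neighbour of a vertex of height d + 1, because
-- heights of adjacent vertices differ by at most one, the tree is balanced and
-- d + 1 is maximal. A vertex w of height d + 1 is not a leaf, so it has two
-- neighbours, and at most one of them is closer to r than w (otherwise the two
-- paths to r close a cycle). Hence w has a child, of height d, whose parent is
-- w. So the image of V_d under the parent map contains V_(d+1) and also
-- r = parent r, which is not in V_(d+1): |V_(d+1)| + 1 ≤ |V_d|.
module Submission where

open import Defs
open import Data.Bool using (true)
import Data.Bool.Properties as Bool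
open import Data.Empty using (⊥-elim)
open import Data.Fin using (Fin; _≟_)
open import Data.Fin.Properties using (any?)
open import Data.List using (List; []; _∷_; _++_; _∷ʳ_; length; map; filterᵇ; allFin; last)
open import Data.List.Properties using (length-++-sucʳ; length-++-≤ˡ; length-map)
open import Data.List.Membership.Propositional using (_∈_)
open import Data.List.Membership.Propositional.Properties
  using (∈-∃++; ∈-++⁻; ∈-++⁺ˡ; ∈-++⁺ʳ; ∈-map⁺; ∈-filter⁺; ∈-filter⁻; ∈-allFin)
open import Data.List.Relation.Binary.Subset.Propositional using (_⊆_)
open import Data.List.Relation.Unary.All as All using (All; []; _∷_)
open import Data.List.Relation.Unary.All.Properties using () renaming (++⁺ to All-++⁺)
open import Data.List.Relation.Unary.AllPairs using ([]; _∷_)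
import Data.List.Relation.Unary.AllPairs.Properties as AllPairs
open import Data.List.Relation.Unary.Any using (here; there)
open import Data.List.Relation.Unary.Linked using (Linked; [-]; _∷_)
import Data.List.Relation.Unary.Linked.Properties as Linked
open import Data.List.Relation.Unary.Unique.Propositional using (Unique)
open import Data.List.Relation.Unary.Unique.Propositional.Properties using (filter⁺; allFin⁺)
open import Data.Maybe using (just)
import Data.Maybe.Relation.Binary.Connected as Maybe
open import Data.Nat using (ℕ; zero; suc; _≤_; _<_; z≤n; s≤s; s≤s⁻¹)
open import Data.Nat.Properties hiding (_≟_)
open import Data.Product using (_×_; _,_; proj₁; proj₂; ∃-syntax; ∃₂)
open import Data.Sum using (_⊎_; inj₁; inj₂)
open import Function using (_∘_)
open import Function.Bundles using (Equivalence)
open import Data.Nat.Induction using (<-wellFounded)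
open import Induction.WellFounded using (Acc; acc)
open import Level using (Level)
open import Relation.Binary.Definitions using (tri<; tri≈; tri>)
open import Relation.Binary.PropositionalEquality
open import Relation.Nullary using (Dec; yes; no; ¬_)
open import Relation.Nullary.Decidable using (map′; _×-dec_; T?)
open import Relation.Unary using (Decidable)

private
  variable
    a : Level
    A : Set a

least-witness : {P : ℕ → Set a} → Decidable P →
  ∀ {k} → P k → ∃[ m ] P m × (∀ {j} → P j → m ≤ j)
least-witness {P = P} P? pk = search _ (<-wellFounded _) pk
  where
  search : ∀ k → Acc _<_ k → P k → ∃[ m ] P m × (∀ {j} → P j → m ≤ j)
  search k (acc smaller) pk with anyUpTo? P? k
  ... | yes (j , j<k , pj) = search j (smaller j<k) pj
  ... | no none = k , pk , λ pj → ≮⇒≥ (λ j<k → none (_ , j<k , pj))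

unique-⊆⇒length≤ : {xs ys : List A} → Unique xs → xs ⊆ ys → length xs ≤ length ys
unique-⊆⇒length≤ {xs = []} _ _ = z≤n
unique-⊆⇒length≤ {xs = x ∷ xs} (x∉xs ∷ xs-unique) x∷xs⊆ys with ∈-∃++ (x∷xs⊆ys (here refl))
... | ys₁ , ys₂ , refl = begin
  suc (length xs)           ≤⟨ s≤s (unique-⊆⇒length≤ xs-unique xs⊆ys₁++ys₂) ⟩
  suc (length (ys₁ ++ ys₂)) ≡⟨ length-++-sucʳ ys₁ x ys₂ ⟨
  length (ys₁ ++ x ∷ ys₂)   ∎
  where
  open ≤-Reasoning
  xs⊆ys₁++ys₂ : xs ⊆ ys₁ ++ ys₂
  xs⊆ys₁++ys₂ y∈xs with ∈-++⁻ ys₁ (x∷xs⊆ys (there y∈xs))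
  ... | inj₁ y∈ys₁         = ∈-++⁺ˡ y∈ys₁
  ... | inj₂ (here refl)   = ⊥-elim (All.lookup x∉xs y∈xs refl)
  ... | inj₂ (there y∈ys₂) = ∈-++⁺ʳ ys₁ y∈ys₂

two-distinct-members : ∀ {x : A} {xs} → Unique xs → x ∈ xs → length xs ≢ 1 →
  ∃₂ λ u₁ u₂ → u₁ ≢ u₂ × u₁ ∈ xs × u₂ ∈ xs
two-distinct-members {xs = _ ∷ []} _ _ length≢1 = ⊥-elim (length≢1 refl)
two-distinct-members {xs = u₁ ∷ u₂ ∷ _} ((u₁≢u₂ ∷ _) ∷ _) _ _ =
  u₁ , u₂ , u₁≢u₂ , here refl , there (here refl)

last-∷ʳ : ∀ (xs : List A) y → last (xs ∷ʳ y) ≡ just y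
last-∷ʳ []           _ = refl
last-∷ʳ (_ ∷ [])     _ = refl
last-∷ʳ (_ ∷ x ∷ xs) y = last-∷ʳ (x ∷ xs) y

module GraphProperties {n : ℕ} (G : Graph n) where
  open Graph G using (adj)

  Adj-sym : ∀ {u v} → Adj G u v → Adj G v u
  Adj-sym {u} {v} uv = trans (Graph.sym G v u) uv

  Adj⇒≢ : ∀ {u v} → Adj G u v → u ≢ v
  Adj⇒≢ {u} uu refl with trans (sym uu) (Graph.irrefl G u)
  ... | ()

  Adj? : ∀ u v → Dec (Adj G u v)
  Adj? u v = adj u v Bool.≟ true

  walk? : ∀ u v m → Dec (Walk G u v m)
  walk? u v zero with u ≟ v
  ... | yes refl = yes here
  ... | no u≢v   = no λ { here → u≢v refl }
  walk? u v (suc m) = map′ (λ (_ , uw , p) → step uw p) (λ { (step uw p) → _ , uw , p })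
    (any? λ w → Adj? u w ×-dec walk? w v m)

  leaf? : ∀ v → Dec (Leaf G v)
  leaf? v = degree G v Data.Nat.≟ 1

  height-exists : ∀ {v ℓ m} → Leaf G ℓ → Walk G v ℓ m → ∃[ k ] V G k v
  height-exists {v} leaf p
    with least-witness (λ k → any? λ ℓ → leaf? ℓ ×-dec walk? v ℓ k) (_ , leaf , p)
  ... | k , reach , minimal = k , reach , λ ℓ m leaf p → minimal (ℓ , leaf , p)

  height-unique : ∀ {v j k} → V G j v → V G k v → j ≡ k
  height-unique ((ℓ , leaf , p) , minimal) ((ℓ′ , leaf′ , p′) , minimal′) =
    ≤-antisym (minimal ℓ′ _ leaf′ p′) (minimal′ ℓ _ leaf p)

  height-adj : ∀ {u v j k} → V G k u → Adj G u v → V G j v → j ≤ suc k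
  height-adj ((ℓ , leaf , p) , _) uv (_ , minimal) = minimal ℓ _ leaf (step (Adj-sym uv) p)

  positive-height⇒two-neighbours : ∀ {w k} → V G (suc k) w →
    ∃₂ λ u₁ u₂ → u₁ ≢ u₂ × Adj G w u₁ × Adj G w u₂
  positive-height⇒two-neighbours {w} ((_ , _ , step {w = x} wx _) , minimal)
    with two-distinct-members (filter⁺ (T? ∘ adj w) (allFin⁺ n))
           (∈-filter⁺ (T? ∘ adj w) (∈-allFin x) (Equivalence.from Bool.T-≡ wx))
           (λ leaf → n≮0 (minimal w 0 leaf here))
  ... | u₁ , u₂ , u₁≢u₂ , u₁∈ , u₂∈ = u₁ , u₂ , u₁≢u₂ , neighbour u₁∈ , neighbour u₂∈
    where
    neighbour : ∀ {u} → u ∈ filterᵇ (adj w) (allFin n) → Adj G w u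
    neighbour = Equivalence.to Bool.T-≡ ∘ proj₂ ∘ ∈-filter⁻ (T? ∘ adj w) {xs = allFin n}

  neighbour-below-top : ∀ {d w u} → Balanced G → (∀ v k → V G k v → k ≤ suc d) →
    V G (suc d) w → Adj G w u → V G d u
  neighbour-below-top {d} {w} {u} balanced bounded w-top@((_ , leaf , p) , _) wu
    with height-exists leaf (step (Adj-sym wu) p)
  ... | h , u-h = subst (λ k → V G k u) h≡d u-h
    where
    h≢1+d : h ≢ suc d
    h≢1+d refl = balanced w u h wu w-top u-h
    h≡d : h ≡ d
    h≡d = ≤-antisym (s≤s⁻¹ (≤∧≢⇒< (bounded u h u-h) h≢1+d))
                    (s≤s⁻¹ (height-adj u-h (Adj-sym wu) w-top))

  module ShortestPaths (r : Fin n) (connected : Connected G) where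

    private
      shortest : ∀ v → ∃[ k ] Walk G v r k × (∀ {j} → Walk G v r j → k ≤ j)
      shortest v = least-witness (walk? v r) (proj₂ (connected v r))

    dist : Fin n → ℕ
    dist v = proj₁ (shortest v)

    geodesic : ∀ v → Walk G v r (dist v)
    geodesic v = proj₁ (proj₂ (shortest v))

    dist-minimal : ∀ {v j} → Walk G v r j → dist v ≤ j
    dist-minimal {v} = proj₂ (proj₂ (shortest v))

    dist-adj : ∀ {u v} → Adj G u v → dist u ≤ suc (dist v)
    dist-adj {v = v} uv = dist-minimal (step uv (geodesic v))

    dist-root : dist r ≡ 0
    dist-root = n≤0⇒n≡0 (dist-minimal here)

    dist≡0⇒root : ∀ {v} → dist v ≡ 0 → v ≡ r
    dist≡0⇒root {v} = start (geodesic v)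
      where
      start : ∀ {m} → Walk G v r m → m ≡ 0 → v ≡ r
      start here refl = refl

    next : ∀ {u v m} → Walk G u v m → Fin n
    next (here {u}) = u
    next (step {w = w} _ _) = w

    parent : Fin n → Fin n
    parent v = next (geodesic v)

    parent-root : parent r ≡ r
    parent-root = next-here (geodesic r) dist-root
      where
      next-here : ∀ {m} (p : Walk G r r m) → m ≡ 0 → next p ≡ r
      next-here here refl = refl

    parent-closer : ∀ {v k} → dist v ≡ suc k → Adj G v (parent v) × dist (parent v) ≡ k
    parent-closer {v} = next-closer (geodesic v) refl
      where
      next-closer : ∀ {m k} (p : Walk G v r m) → dist v ≡ m → m ≡ suc k →
        Adj G v (next p) × dist (next p) ≡ k
      next-closer (step vw p) dv refl =
        vw , ≤-antisym (dist-minimal p) (s≤s⁻¹ (subst (_≤ _) dv (dist-adj vw)))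

    low≢high : ∀ {z v k} → dist z ≤ k → dist v ≡ suc k → z ≢ v
    low≢high {k = k} z≤k dv refl = 1+n≰n (subst (_≤ k) dv z≤k)

    -- A path from x to y with at least three vertices, all within distance k of r;
    -- an edge y x would close it into a cycle.
    record LowPath (x y : Fin n) (k : ℕ) : Set where
      field
        inner  : List (Fin n)
        long   : 2 ≤ length inner
        unique : Unique (x ∷ inner)
        linked : Linked (Adj G) (x ∷ inner)
        ends   : last (x ∷ inner) ≡ just y
        low    : All (λ z → dist z ≤ k) (x ∷ inner)
    open LowPath

    cherry : ∀ {x y p k} → Adj G x p → Adj G y p → dist p ≡ k →
      dist x ≡ suc k → dist y ≡ suc k → x ≢ y → LowPath x y (suc k)
    cherry {y = y} {p} xp yp dp dx dy x≢y = record
      { inner  = p ∷ y ∷ []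
      ; long   = s≤s (s≤s z≤n)
      ; unique = (≢-sym (low≢high p≤k dx) ∷ x≢y ∷ []) ∷ (low≢high p≤k dy ∷ []) ∷ [] ∷ []
      ; linked = xp ∷ Adj-sym yp ∷ [-]
      ; ends   = refl
      ; low    = ≤-reflexive dx ∷ m≤n⇒m≤1+n p≤k ∷ ≤-reflexive dy ∷ []
      }
      where
      p≤k = ≤-reflexive dp

    prepend : ∀ {u w y k} → LowPath w y k → Adj G u w → dist u ≡ suc k → LowPath u y (suc k)
    prepend {w = w} P uw du = record
      { inner  = w ∷ inner P
      ; long   = m≤n⇒m≤1+n (long P)
      ; unique = All.map (λ z≤k → ≢-sym (low≢high z≤k du)) (low P) ∷ unique P
      ; linked = uw ∷ linked P
      ; ends   = ends P
      ; low    = ≤-reflexive du ∷ All.map m≤n⇒m≤1+n (low P)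
      }

    append : ∀ {x y′ y k} (P : LowPath x y′ k) → Adj G y′ y → All (_≢ y) (x ∷ inner P) →
      dist y ≤ k → LowPath x y k
    append {x} {y = y} P y′y fresh y≤k = record
      { inner  = inner P ∷ʳ y
      ; long   = ≤-trans (long P) (length-++-≤ˡ (inner P))
      ; unique = AllPairs.++⁺ (unique P) ([] ∷ []) (All.map (_∷ []) fresh)
      ; linked = Linked.++⁺ (linked P)
                   (subst (λ e → Maybe.Connected (Adj G) e (just y)) (sym (ends P)) (Maybe.just y′y)) [-]
      ; ends   = last-∷ʳ (x ∷ inner P) y
      ; low    = All-++⁺ (low P) (y≤k ∷ [])
      }

    extend : ∀ {x x′ y′ y k} → LowPath x′ y′ k → Adj G x x′ → Adj G y′ y →
      dist x ≡ suc k → dist y ≡ suc k → x ≢ y → LowPath x y (suc k)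
    extend P xx′ y′y dx dy x≢y =
      append (prepend P xx′ dx) y′y (x≢y ∷ All.map (λ z≤k → low≢high z≤k dy) (low P))
        (≤-reflexive dy)

    low-path : ∀ k {x y} → x ≢ y → dist x ≡ k → dist y ≡ k → LowPath x y k
    low-path zero x≢y dx dy = ⊥-elim (x≢y (trans (dist≡0⇒root dx) (sym (dist≡0⇒root dy))))
    low-path (suc k) {x} {y} x≢y dx dy with parent-closer dx | parent-closer dy | parent x ≟ parent y
    ... | xp , dp | yp , _ | yes px≡py = cherry xp (subst (Adj G y) (sym px≡py) yp) dp dx dy x≢y
    ... | xp , dp | yp , dp′ | no px≢py = extend (low-path k px≢py dp dp′) xp (Adj-sym yp) dx dy x≢y

    module _ (acyclic : Acyclic G) where

      low-path-unclosed : ∀ {x y k} → LowPath x y k → ¬ Adj G y x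
      low-path-unclosed {x} {y} P yx = acyclic (x ∷ inner P) (long P , unique P , linked P , y , ends P , yx)

      Adj⇒dist≢ : ∀ {x y} → Adj G x y → dist x ≢ dist y
      Adj⇒dist≢ xy dx≡dy = low-path-unclosed (low-path _ (Adj⇒≢ xy) refl (sym dx≡dy)) (Adj-sym xy)

      closer-neighbour-unique : ∀ {u w w′ k} → Adj G u w → Adj G u w′ →
        dist w ≡ k → dist w′ ≡ k → dist u ≡ suc k → w ≡ w′
      closer-neighbour-unique {w = w} {w′} {k} uw uw′ dw dw′ du with w ≟ w′
      ... | yes w≡w′ = w≡w′
      ... | no w≢w′  = ⊥-elim (low-path-unclosed (prepend (low-path k w≢w′ dw dw′) uw du) (Adj-sym uw′))

      Adj⇒dist-suc : ∀ {u v} → Adj G u v → dist v ≡ suc (dist u) ⊎ dist u ≡ suc (dist v)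
      Adj⇒dist-suc {u} {v} uv with <-cmp (dist u) (dist v)
      ... | tri< du<dv _ _ = inj₁ (≤-antisym (dist-adj (Adj-sym uv)) du<dv)
      ... | tri≈ _ du≡dv _ = ⊥-elim (Adj⇒dist≢ uv du≡dv)
      ... | tri> _ _ du>dv = inj₂ (≤-antisym (dist-adj uv) du>dv)

      child-exists : ∀ {w u₁ u₂} → u₁ ≢ u₂ → Adj G w u₁ → Adj G w u₂ →
        ∃[ u ] Adj G w u × dist u ≡ suc (dist w)
      child-exists {u₁ = u₁} {u₂} u₁≢u₂ wu₁ wu₂ with Adj⇒dist-suc wu₁ | Adj⇒dist-suc wu₂
      ... | inj₁ du₁ | _        = u₁ , wu₁ , du₁
      ... | inj₂ _   | inj₁ du₂ = u₂ , wu₂ , du₂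
      ... | inj₂ dw₁ | inj₂ dw₂ =
        ⊥-elim (u₁≢u₂ (closer-neighbour-unique wu₁ wu₂ refl (suc-injective (trans (sym dw₂) dw₁)) dw₁))

      parent-of-child : ∀ {w u} → Adj G w u → dist u ≡ suc (dist w) → parent u ≡ w
      parent-of-child wu du with parent-closer du
      ... | up , dp = closer-neighbour-unique up (Adj-sym wu) dp refl du

lemma4p4 : (n : ℕ) (G : Graph n) (d : ℕ) → IsTree G → Balanced G →
    TreeHeight G (suc d) →
    (a b : ℕ) → Card (V G d) a → Card (V G (suc d)) b → b < a
lemma4p4 n G d (connected , acyclic) balanced ((_ , w₀-top@((_ , _ , step {w = r} w₀r _) , _)) , bounded)
         _ _ (ys , _ , ys-V , refl) (xs , xs-unique , xs-V , refl) = begin-strict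
  length xs              <⟨ unique-⊆⇒length≤ (All.tabulate r∉xs ∷ xs-unique) cover ⟩
  length (map parent ys) ≡⟨ length-map parent ys ⟩
  length ys              ∎
  where
  open ≤-Reasoning
  open GraphProperties G
  open ShortestPaths r connected

  top : ∀ {w} → w ∈ xs → V G (suc d) w
  top = Equivalence.to (xs-V _)

  parent-in-image : ∀ {w u} → V G d u → parent u ≡ w → w ∈ map parent ys
  parent-in-image u-d refl = ∈-map⁺ parent (Equivalence.from (ys-V _) u-d)

  r-d : V G d r
  r-d = neighbour-below-top balanced bounded w₀-top w₀r

  r∉xs : ∀ {w} → w ∈ xs → r ≢ w
  r∉xs w∈xs refl = 1+n≢n (sym (height-unique r-d (top w∈xs)))

  cover : r ∷ xs ⊆ map parent ys
  cover (here refl) = parent-in-image r-d parent-root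
  cover (there w∈xs) with positive-height⇒two-neighbours (top w∈xs)
  ... | _ , _ , u₁≢u₂ , wu₁ , wu₂ with child-exists acyclic u₁≢u₂ wu₁ wu₂
  ... | _ , wu , du = parent-in-image (neighbour-below-top balanced bounded (top w∈xs) wu)
                                      (parent-of-child acyclic wu du)
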